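{- Let $h\geq 1$ and let $\vec c=[c_1,\ldots,c_{h'}]$ be a sequence of positive integers. If the perfect binary tree $T(h)$ admits an ancestral $\vec c$-coloring, then $h'\geq h$. Moreover, if $h'=h$, then all $h$ colors appear on the non-root nodes of every root-to-leaf path; equivalently, for each color $i\in\{1,\ldots,h\}$, the nodes of color $i$ collectively lie on all $2^h$ root-to-leaf paths of $T(h)$.
   Context: $T(h)$ denotes the perfect binary tree of height $h$: nodes $1,\ldots,2^{h+1}-1$, root $1$, children of $R$ are $2R,2R+1$; it has $2^h$ leaves and hence $2^h$ root-to-leaf paths. An ancestral $\vec c$-coloring with $\vec c=[c_1,\ldots,c_{h'}]$ is an assignment of colors from $\{1,\ldots,h'\}$ to all nodes except the (colorless) root such that exactly $c_i$ nodes receive color $i$ and no node has the same color as any of its ancestors. -}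

module Defs where

open import Data.Nat using (ℕ; zero; suc; _+_; _^_; _≤_; _<_; ⌊_/2⌋)
open import Data.Fin using (Fin) renaming (_≟_ to _≟ᶠ_)
open import Data.List using (List; map; upTo; filter; length)
open import Data.Product using (_×_; ∃-syntax)
open import Relation.Binary.PropositionalEquality using (_≡_; _≢_)

-- Perfect binary tree T(h): nodes 1 .. 2^(h+1) - 1, root 1, children of R are 2R, 2R+1.
-- Hence the parent of v ≥ 2 is ⌊ v / 2 ⌋.

up : ℕ → ℕ → ℕ
up zero    v = v
up (suc k) v = ⌊ up k v /2⌋

NonRoot : ℕ → ℕ → Set
NonRoot h v = 2 ≤ v × v < 2 ^ (suc h)

Leaf : ℕ → ℕ → Set
Leaf h v = 2 ^ h ≤ v × v < 2 ^ (suc h)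

Ancestor : ℕ → ℕ → Set
Ancestor u v = ∃[ k ] (1 ≤ k × up k v ≡ u)

nonRootNodes : ℕ → List ℕ
nonRootNodes h = map (2 +_) (upTo (2 ^ (suc h) Data.Nat.∸ 2))

colourCount : ∀ {h'} → ℕ → (ℕ → Fin h') → Fin h' → ℕ
colourCount h col i = length (filter (λ v → col v ≟ᶠ i) (nonRootNodes h))

-- Ancestral c-colouring of T(h), colours Fin h' (= {1..h'}), c : Fin h' → ℕ.
-- col is only relevant on non-root nodes (the root is colourless).
record AncestralColouring (h h' : ℕ) (c : Fin h' → ℕ) : Set where
  field
    col       : ℕ → Fin h'
    counts    : ∀ i → colourCount h col i ≡ c i
    ancestral : ∀ u v → NonRoot h u → NonRoot h v → Ancestor u v → col u ≢ col v

{-# OPTIONS --safe #-}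
-- Along a root-to-leaf path of T(h) any two non-root nodes are comparable in
-- the ancestor order, so an ancestral colouring gives the h non-root nodes of a
-- path pairwise distinct colours. Hence h ≤ h', and when h' = h the colouring
-- of a path is an injection Fin h → Fin h, thus onto: every colour occurs on
-- every root-to-leaf path.
module Submission where

open import Defs
open import Data.Nat using (ℕ; zero; suc; _+_; _^_; _∸_; ⌊_/2⌋; _≤_; _<_; z≤n; s≤s)
open import Data.Nat.Properties
open import Data.Fin using (Fin; toℕ; punchOut)
open import Data.Fin.Properties
  using (toℕ-injective; toℕ<n; injective⇒≤; any?; punchOut-injective)
  renaming (_≟_ to _≟ᶠ_)
open import Data.Product using (_×_; ∃-syntax; _,_)
open import Data.Empty using (⊥-elim)
open import Function.Definitions using (Injective)
open import Relation.Binary.Definitions using (tri<; tri≈; tri>)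
open import Relation.Binary.PropositionalEquality
open import Relation.Nullary using (yes; no)

-- If i were missed, punching it out would inject Fin (suc n) into Fin n.
Fin-injective⇒surjective : ∀ {n} {f : Fin n → Fin n} →
                           Injective _≡_ _≡_ f → ∀ i → ∃[ k ] (f k ≡ i)
Fin-injective⇒surjective {suc n} {f} f-inj i with any? (λ k → f k ≟ᶠ i)
... | yes hit = hit
... | no miss = ⊥-elim (<-irrefl refl (injective⇒≤ punched-injective))
  where
  punched : Fin (suc n) → Fin n
  punched k = punchOut {i = i} (λ i≡fk → miss (k , sym i≡fk))

  punched-injective : Injective _≡_ _≡_ punched
  punched-injective eq = f-inj (punchOut-injective {i = i} _ _ eq)

up-+ : ∀ m n v → up (m + n) v ≡ up m (up n v)
up-+ zero    n v = refl
up-+ (suc m) n v = cong ⌊_/2⌋ (up-+ m n v)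

up-≤ : ∀ k v → up k v ≤ v
up-≤ zero    v = ≤-refl
up-≤ (suc k) v = ≤-trans (⌊n/2⌋≤n (up k v)) (up-≤ k v)

n+n≤v⇒n≤⌊v/2⌋ : ∀ {n v} → n + n ≤ v → n ≤ ⌊ v /2⌋
n+n≤v⇒n≤⌊v/2⌋ {n} n+n≤v = subst (_≤ _) (sym (n≡⌊n+n/2⌋ n)) (⌊n/2⌋-mono n+n≤v)

2^[m+k]≤v⇒2^m≤up : ∀ m k v → 2 ^ (m + k) ≤ v → 2 ^ m ≤ up k v
2^[m+k]≤v⇒2^m≤up m zero    v le = subst (λ e → 2 ^ e ≤ v) (+-identityʳ m) le
2^[m+k]≤v⇒2^m≤up m (suc k) v le = n+n≤v⇒n≤⌊v/2⌋ (subst (_≤ up k v) 2^[1+m]≡2^m+2^m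
  (2^[m+k]≤v⇒2^m≤up (suc m) k v (subst (λ e → 2 ^ e ≤ v) (+-suc m k) le)))
  where
  2^[1+m]≡2^m+2^m : 2 ^ suc m ≡ 2 ^ m + 2 ^ m
  2^[1+m]≡2^m+2^m = cong (2 ^ m +_) (+-identityʳ (2 ^ m))

leaf-up-nonRoot : ∀ {h ℓ k} → Leaf h ℓ → k < h → NonRoot h (up k ℓ)
leaf-up-nonRoot {h} {ℓ} {k} (2^h≤ℓ , ℓ<2^[1+h]) k<h =
  2^[m+k]≤v⇒2^m≤up 1 k ℓ (≤-trans (^-monoʳ-≤ 2 k<h) 2^h≤ℓ) ,
  ≤-<-trans (up-≤ k ℓ) ℓ<2^[1+h]

up-ancestor : ∀ v {a b} → a < b → Ancestor (up b v) (up a v)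
up-ancestor v {a} {b} a<b = b ∸ a , m<n⇒0<n∸m a<b ,
  trans (sym (up-+ (b ∸ a) a v)) (cong (λ e → up e v) (m∸n+n≡m (<⇒≤ a<b)))

2^h-leaf : ∀ h → Leaf h (2 ^ h)
2^h-leaf h = ≤-refl , ^-monoʳ-< 2 (s≤s (s≤s z≤n)) (n<1+n h)

module _ {h h' c} (C : AncestralColouring h h' c) {ℓ} (L : Leaf h ℓ) where
  open AncestralColouring C

  pathColour : Fin h → Fin h'
  pathColour k = col (up (toℕ k) ℓ)

  distinct : ∀ {a b} → b < h → a < h → a < b → col (up b ℓ) ≢ col (up a ℓ)
  distinct b<h a<h a<b = ancestral _ _ (leaf-up-nonRoot L b<h) (leaf-up-nonRoot L a<h)
                                   (up-ancestor ℓ a<b)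

  pathColour-injective : Injective _≡_ _≡_ pathColour
  pathColour-injective {i} {j} same with <-cmp (toℕ i) (toℕ j)
  ... | tri< i<j _ _ = ⊥-elim (distinct (toℕ<n j) (toℕ<n i) i<j (sym same))
  ... | tri≈ _ i≡j _ = toℕ-injective i≡j
  ... | tri> _ _ j<i = ⊥-elim (distinct (toℕ<n i) (toℕ<n j) j<i same)

lemma1 : (h h' : ℕ) → 1 ≤ h → (c : Fin h' → ℕ) → (∀ i → 1 ≤ c i) →
         (C : AncestralColouring h h' c) →
         h ≤ h' ×
         (h' ≡ h → ∀ ℓ → Leaf h ℓ → ∀ (i : Fin h') →
            ∃[ k ] (k < h × AncestralColouring.col C (up k ℓ) ≡ i))
lemma1 h h' _ c _ C = injective⇒≤ (pathColour-injective C (2^h-leaf h)) , every-colour-on-path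
  where
  every-colour-on-path : h' ≡ h → ∀ ℓ → Leaf h ℓ → ∀ (i : Fin h') →
                         ∃[ k ] (k < h × AncestralColouring.col C (up k ℓ) ≡ i)
  every-colour-on-path refl ℓ L i with Fin-injective⇒surjective (pathColour-injective C L) i
  ... | k , colour-k≡i = toℕ k , toℕ<n k , colour-k≡i
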